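{- Let $L'$ be a finite geometric lattice of height $n$ and let $L$ be a distributive sublattice of $L'$. Then the Whitney numbers of $L$ satisfy $W_k(L)\le\binom{n}{k}$ for all $k\in\{0,1,\dots,n\}$, with equality (for all $k$) if and only if $L$ contains $n$ atoms.
   Context: For a finite lattice $L$ with least element $O$, the height $h_L(x)$ of $x\in L$ is the maximum length of a chain in $L$ from $O$ to $x$, and the Whitney number is $W_k(L)=|\{x\in L: h_L(x)=k\}|$. Atoms of a lattice are the elements covering its least element. A sublattice is a subset closed under join and meet. A finite lattice is geometric if it is semimodular (whenever $x\wedge y$ is covered by both $x$ and $y$, both are covered by $x\vee y$) and atomistic (every element is a join of atoms). The height of $L'$ is the maximum length of a chain from its least to its greatest element. Distributive means $x\wedge(y\vee z)=(x\wedge y)\vee(x\wedge z)$ for all $x,y,z$. -}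

module Defs where

open import Level using (0ℓ)
open import Data.Nat using (ℕ; zero; suc) renaming (_≤_ to _≤ℕ_)
open import Data.Fin using (Fin)
open import Data.Fin.Subset using (Subset; _∈_; ⊤)
open import Data.List using (List; []; _∷_; length; foldr)
open import Data.List.Relation.Unary.All using (All)
open import Data.List.Relation.Unary.Unique.Propositional using (Unique)
import Data.List.Membership.Propositional as LM
open import Data.Product using (Σ; ∃; _×_; _,_)
open import Relation.Binary.PropositionalEquality using (_≡_; _≢_)
open import Relation.Binary.Core using (Rel)
open import Algebra.Core using (Op₂)
open import Relation.Binary.Lattice.Structures using (IsBoundedLattice)
open import Relation.Nullary using (¬_)
open import Function.Bundles using (_⇔_)

-- A finite lattice, presented (up to isomorphism) on the carrier Fin size,
-- with propositional equality; every finite lattice is bounded.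
record FiniteLattice : Set₁ where
  field
    size : ℕ
    _≤_ : Rel (Fin size) 0ℓ
    _∨_ _∧_ : Op₂ (Fin size)
    top bot : Fin size
    isBoundedLattice : IsBoundedLattice _≡_ _≤_ _∨_ _∧_ top bot

module _ (L : FiniteLattice) where
  open FiniteLattice L

  _<_ : Rel (Fin size) 0ℓ
  x < y = (x ≤ y) × (x ≢ y)

  data Chain (S : Subset size) : Fin size → Fin size → ℕ → Set where
    here : ∀ {x} → x ∈ S → Chain S x x zero
    step : ∀ {x y z k} → x ∈ S → x < y → Chain S y z k → Chain S x z (suc k)

  IsLeastIn : Subset size → Fin size → Set
  IsLeastIn S o = (o ∈ S) × (∀ y → y ∈ S → o ≤ y)

  HeightIn : Subset size → Fin size → ℕ → Set
  HeightIn S x k = Σ (Fin size) λ o → IsLeastIn S o × Chain S o x k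
                     × (∀ j → Chain S o x j → j ≤ℕ k)

  Card : (Fin size → Set) → ℕ → Set
  Card P c = Σ (List (Fin size)) λ xs → Unique xs
               × (∀ x → (x LM.∈ xs) ⇔ P x) × (length xs ≡ c)

  Whitney : Subset size → ℕ → ℕ → Set
  Whitney S k c = Card (λ x → (x ∈ S) × HeightIn S x k) c

  CoversIn : Subset size → Fin size → Fin size → Set
  CoversIn S a b = (a ∈ S) × (b ∈ S) × (a < b)
                   × (∀ c → c ∈ S → a < c → ¬ (c < b))

  IsAtomIn : Subset size → Fin size → Set
  IsAtomIn S a = Σ (Fin size) λ o → IsLeastIn S o × CoversIn S o a

  LatticeHeight : ℕ → Set
  LatticeHeight n = HeightIn ⊤ top n

  Semimodular : Set
  Semimodular = ∀ x y → CoversIn ⊤ (x ∧ y) x → CoversIn ⊤ (x ∧ y) y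
                → CoversIn ⊤ x (x ∨ y) × CoversIn ⊤ y (x ∨ y)

  Atomistic : Set
  Atomistic = ∀ x → Σ (List (Fin size)) λ as → All (IsAtomIn ⊤) as
                × (foldr _∨_ bot as ≡ x)

  Geometric : Set
  Geometric = Semimodular × Atomistic

  IsSublattice : Subset size → Set
  IsSublattice S = (∃ λ x → x ∈ S)
                   × (∀ x y → x ∈ S → y ∈ S → ((x ∨ y) ∈ S) × ((x ∧ y) ∈ S))

  DistributiveOn : Subset size → Set
  DistributiveOn S = ∀ x y z → x ∈ S → y ∈ S → z ∈ S
                     → x ∧ (y ∨ z) ≡ (x ∧ y) ∨ (x ∧ z)

{-# OPTIONS --safe #-}
-- By Birkhoff's argument, every x in the finite distributive lattice S is the join of the set J(x)
-- of join-irreducibles of S below it, and join-irreducibles are join-prime. Hence x ↦ J(x) is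
-- injective, a cover in S adds exactly one join-irreducible, and the height of x in S is |J(x)|.
-- So W_k(S) is at most the number of k-subsets of the m join-irreducibles, and m ≤ n because a
-- maximal chain of S has length m and is a chain of L'. Equality at k = 1 says S has n atoms.
-- Conversely, n atoms are n join-irreducibles, hence all of them; being an antichain, every
-- subset of them is J of its own join, so W_k(S) is exactly the number of k-subsets.
module Submission where

open import Data.Nat using (ℕ; zero; suc; _+_; z≤n; s≤s; _≤′_; ≤′-reflexive; ≤′-step)
  renaming (_≤_ to _≤ℕ_; _<_ to _<ℕ_; _≤?_ to _≤ℕ?_)
import Data.Nat.Properties as ℕₚ
open import Data.Nat.Induction using () renaming (<-wellFounded to <ℕ-wellFounded)
open import Data.Nat.Combinatorics using (_C_; nCk+nC[k+1]≡[n+1]C[k+1]; nC1≡n)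
open import Data.Fin using (Fin; zero; suc)
open import Data.Fin.Properties using (_≟_; any?; suc-injective)
open import Data.Fin.Subset
  using (Subset; inside; outside; _∈_; _∉_; _⊆_; _⊂_; ∣_∣; ⊤; ⊥)
open import Data.Fin.Subset.Properties
  using (_∈?_; ∈⊤; drop-there; drop-∷-⊆; ⊆-antisym; p⊆q⇒∣p∣≤∣q∣; p⊂q⇒∣p∣<∣q∣; ∣⊤∣≡n; ∣⊥∣≡0)
open import Data.Vec using ([]; _∷_; here; there; tabulate)
open import Data.Vec.Properties using (lookup∘tabulate; lookup⇒[]=; []=⇒lookup; ∷-injectiveʳ)
open import Data.List using (List; []; _∷_; length; map; _++_; foldr; filter; lookup; allFin)
open import Data.List.Properties using (length-map; length-++; length-removeAt′)
open import Data.List.Membership.Propositional using (_─_) renaming (_∈_ to _∈ˡ_)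
open import Data.List.Membership.Propositional.Properties
  using (∈-++⁺ˡ; ∈-++⁺ʳ; ∈-++⁻; ∈-map⁺; ∈-map⁻; ∈-filter⁺; ∈-filter⁻; ∈-lookup; ∈-allFin)
import Data.List.Membership.DecPropositional as DecMembership
open import Data.List.Relation.Unary.Any using (here; there; index)
open import Data.List.Relation.Unary.Any.Properties using (lookup-index)
open import Data.List.Relation.Unary.All as All using (All; []; _∷_)
open import Data.List.Relation.Unary.All.Properties using (all-filter)
open import Data.List.Relation.Unary.Unique.Propositional using (Unique; []; _∷_)
import Data.List.Relation.Unary.Unique.Propositional.Properties as Unique
open import Data.List.Relation.Binary.Disjoint.Propositional using (Disjoint)
open import Data.Product using (Σ; ∃; ∃₂; _×_; _,_; proj₁; proj₂)
open import Data.Sum using (_⊎_; inj₁; inj₂)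
import Data.Sum as Sum
open import Data.Empty using (⊥-elim)
open import Function.Base using (_∘_; id)
open import Function.Bundles using (_⇔_; mk⇔; Equivalence)
import Function.Properties.Equivalence as ⇔
open import Induction.WellFounded using (WellFounded; Acc; acc; module Subrelation)
import Relation.Binary.Construct.On as On
open import Relation.Binary.Definitions using (DecidableEquality)
open import Relation.Binary.Lattice.Structures using (IsBoundedLattice)
open import Relation.Binary.Structures using (IsPartialOrder)
open import Relation.Binary.PropositionalEquality
open import Relation.Nullary using (¬_; Dec; yes; no; does; contradiction)
open import Relation.Nullary.Decidable using (_×-dec_; ¬?; map′; dec-true)
open import Relation.Unary using (Decidable)
open import Defs hiding (_<_)

∈-─⁺ : ∀ {A : Set} {x y} {zs : List A} (x∈zs : x ∈ˡ zs) → y ∈ˡ zs → y ≢ x → y ∈ˡ zs ─ x∈zs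
∈-─⁺ (here refl) (here refl) y≢x = ⊥-elim (y≢x refl)
∈-─⁺ (here refl) (there y∈zs) _ = y∈zs
∈-─⁺ (there _) (here refl) _ = here refl
∈-─⁺ (there x∈zs) (there y∈zs) y≢x = there (∈-─⁺ x∈zs y∈zs y≢x)

module _ {A : Set} where

  lookup-injective : {xs : List A} → Unique xs → ∀ i j → lookup xs i ≡ lookup xs j → i ≡ j
  lookup-injective (_ ∷ _) zero zero _ = refl
  lookup-injective {_ ∷ xs} (x∉xs ∷ _) zero (suc j) eq =
    ⊥-elim (All.lookup x∉xs (∈-lookup {xs = xs} j) eq)
  lookup-injective {_ ∷ xs} (x∉xs ∷ _) (suc i) zero eq =
    ⊥-elim (All.lookup x∉xs (∈-lookup {xs = xs} i) (sym eq))
  lookup-injective (_ ∷ u) (suc i) (suc j) eq = cong suc (lookup-injective u i j eq)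

  injection⇒length≤ : ∀ {B : Set} (f : A → B) {xs : List A} {zs : List B} → Unique xs
    → (∀ {x y} → x ∈ˡ xs → y ∈ˡ xs → f x ≡ f y → x ≡ y)
    → (∀ {x} → x ∈ˡ xs → f x ∈ˡ zs)
    → length xs ≤ℕ length zs
  injection⇒length≤ f {[]} _ _ _ = z≤n
  injection⇒length≤ f {x ∷ xs} {zs} (x∉xs ∷ u) inj into = begin
    suc (length xs)           ≤⟨ s≤s (injection⇒length≤ f u (λ p q → inj (there p) (there q)) into′) ⟩
    suc (length (zs ─ fx∈zs)) ≡⟨ sym (length-removeAt′ zs (index fx∈zs)) ⟩
    length zs                 ∎
    where
    open ℕₚ.≤-Reasoning
    fx∈zs : f x ∈ˡ zs
    fx∈zs = into (here refl)
    into′ : ∀ {y} → y ∈ˡ xs → f y ∈ˡ zs ─ fx∈zs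
    into′ y∈xs = ∈-─⁺ fx∈zs (into (there y∈xs))
      (λ fy≡fx → All.lookup x∉xs y∈xs (inj (here refl) (there y∈xs) (sym fy≡fx)))

  unique-⊆⇒⊇ : DecidableEquality A → {xs ys : List A} → Unique xs
    → (∀ {x} → x ∈ˡ xs → x ∈ˡ ys) → length ys ≤ℕ length xs
    → ∀ {y} → y ∈ˡ ys → y ∈ˡ xs
  unique-⊆⇒⊇ _≟ᴬ_ {xs} {ys} u xs⊆ys ys≤xs {y} y∈ys with DecMembership._∈?_ _≟ᴬ_ y xs
  ... | yes y∈xs = y∈xs
  ... | no y∉xs = contradiction (ℕₚ.≤-trans y∷xs≤ys ys≤xs) (ℕₚ.<-irrefl refl)
    where
    y∷xs≤ys : length (y ∷ xs) ≤ℕ length ys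
    y∷xs≤ys = injection⇒length≤ id
      (All.tabulate (λ x∈xs y≡x → y∉xs (subst (_∈ˡ xs) (sym y≡x) x∈xs)) ∷ u)
      (λ _ _ eq → eq)
      (λ { (here refl) → y∈ys ; (there x∈xs) → xs⊆ys x∈xs })

C-suc-≤ : ∀ n k → n C k ≤ℕ suc n C k
C-suc-≤ n zero = ℕₚ.≤-refl
C-suc-≤ n (suc k) = subst (n C suc k ≤ℕ_) (nCk+nC[k+1]≡[n+1]C[k+1] n k) (ℕₚ.m≤n+m _ _)

C-monoˡ-≤′ : ∀ k {m n} → m ≤′ n → m C k ≤ℕ n C k
C-monoˡ-≤′ k (≤′-reflexive refl) = ℕₚ.≤-refl
C-monoˡ-≤′ k (≤′-step m≤′n) = ℕₚ.≤-trans (C-monoˡ-≤′ k m≤′n) (C-suc-≤ _ k)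

C-monoˡ-≤ : ∀ k {m n} → m ≤ℕ n → m C k ≤ℕ n C k
C-monoˡ-≤ k = C-monoˡ-≤′ k ∘ ℕₚ.≤⇒≤′

select : ∀ {m} {P : Fin m → Set} → Decidable P → Subset m
select P? = tabulate (does ∘ P?)

module _ {m} {P : Fin m → Set} (P? : Decidable P) where

  ∈-select⁺ : ∀ {i} → P i → i ∈ select P?
  ∈-select⁺ {i} Pi = lookup⇒[]= i (select P?) (trans (lookup∘tabulate _ i) (dec-true (P? i) Pi))

  ∈-select⁻ : ∀ {i} → i ∈ select P? → P i
  ∈-select⁻ {i} i∈ with P? i | trans (sym (lookup∘tabulate (does ∘ P?) i)) ([]=⇒lookup i∈)
  ... | yes Pi | _ = Pi
  ... | no _ | ()

⊆∧≢⇒⊂ : ∀ {m} {p q : Subset m} → p ⊆ q → p ≢ q → p ⊂ q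
⊆∧≢⇒⊂ {p = p} {q} p⊆q p≢q with any? (λ i → (i ∈? q) ×-dec ¬? (i ∈? p))
... | yes (i , i∈q , i∉p) = p⊆q , i , i∈q , i∉p
... | no none = ⊥-elim (p≢q (⊆-antisym p⊆q q⊆p))
  where
  q⊆p : q ⊆ p
  q⊆p {i} i∈q with i ∈? p
  ... | yes i∈p = i∈p
  ... | no i∉p = ⊥-elim (none (i , i∈q , i∉p))

AtMostOneNew : ∀ {m} → Subset m → Subset m → Set
AtMostOneNew p q = ∀ {i j} → i ∈ q → i ∉ p → j ∈ q → j ∉ p → i ≡ j

atMostOneNew-tail : ∀ {m s t} {p q : Subset m} → AtMostOneNew (s ∷ p) (t ∷ q) → AtMostOneNew p q
atMostOneNew-tail new i∈ i∉ j∈ j∉ =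
  suc-injective (new (there i∈) (i∉ ∘ drop-there) (there j∈) (j∉ ∘ drop-there))

∣q∣≤1+∣p∣ : ∀ {m} {p q : Subset m} → p ⊆ q → AtMostOneNew p q → ∣ q ∣ ≤ℕ suc ∣ p ∣
∣q∣≤1+∣p∣ {p = []} {[]} _ _ = z≤n
∣q∣≤1+∣p∣ {p = outside ∷ p} {outside ∷ q} p⊆q new =
  ∣q∣≤1+∣p∣ (drop-∷-⊆ p⊆q) (atMostOneNew-tail new)
∣q∣≤1+∣p∣ {p = inside ∷ p} {inside ∷ q} p⊆q new =
  s≤s (∣q∣≤1+∣p∣ (drop-∷-⊆ p⊆q) (atMostOneNew-tail new))
∣q∣≤1+∣p∣ {p = inside ∷ p} {outside ∷ q} p⊆q _ = contradiction (p⊆q here) λ ()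
∣q∣≤1+∣p∣ {p = outside ∷ p} {inside ∷ q} _ new = s≤s (p⊆q⇒∣p∣≤∣q∣ q⊆p)
  where
  q⊆p : q ⊆ p
  q⊆p {i} i∈q with i ∈? p
  ... | yes i∈p = i∈p
  ... | no i∉p = contradiction (new (there i∈q) (i∉p ∘ drop-there) here λ ()) λ ()

ofSize : (m k : ℕ) → List (Subset m)
ofSize zero zero = [] ∷ []
ofSize zero (suc k) = []
ofSize (suc m) zero = map (outside ∷_) (ofSize m zero)
ofSize (suc m) (suc k) = map (inside ∷_) (ofSize m k) ++ map (outside ∷_) (ofSize m (suc k))

length-ofSize : ∀ m k → length (ofSize m k) ≡ m C k
length-ofSize zero zero = refl
length-ofSize zero (suc k) = refl
length-ofSize (suc m) zero = trans (length-map _ (ofSize m zero)) (length-ofSize m zero)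
length-ofSize (suc m) (suc k) = begin
  length (map (inside ∷_) (ofSize m k) ++ map (outside ∷_) (ofSize m (suc k)))
    ≡⟨ length-++ (map (inside ∷_) (ofSize m k)) ⟩
  length (map (inside ∷_) (ofSize m k)) + length (map (outside ∷_) (ofSize m (suc k)))
    ≡⟨ cong₂ _+_ (length-map _ (ofSize m k)) (length-map _ (ofSize m (suc k))) ⟩
  length (ofSize m k) + length (ofSize m (suc k))
    ≡⟨ cong₂ _+_ (length-ofSize m k) (length-ofSize m (suc k)) ⟩
  m C k + m C suc k
    ≡⟨ nCk+nC[k+1]≡[n+1]C[k+1] m k ⟩
  suc m C suc k ∎
  where open ≡-Reasoning

ofSize-unique : ∀ m k → Unique (ofSize m k)
ofSize-unique zero zero = [] ∷ []
ofSize-unique zero (suc k) = []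
ofSize-unique (suc m) zero = Unique.map⁺ ∷-injectiveʳ (ofSize-unique m zero)
ofSize-unique (suc m) (suc k) =
  Unique.++⁺ (Unique.map⁺ ∷-injectiveʳ (ofSize-unique m k))
             (Unique.map⁺ ∷-injectiveʳ (ofSize-unique m (suc k)))
             disjoint
  where
  disjoint : Disjoint (map (inside ∷_) (ofSize m k)) (map (outside ∷_) (ofSize m (suc k)))
  disjoint (p∈ , q∈) with ∈-map⁻ (inside ∷_) p∈ | ∈-map⁻ (outside ∷_) q∈
  ... | _ , _ , refl | _ , _ , ()

∈-ofSize⁺ : ∀ {m} (p : Subset m) → p ∈ˡ ofSize m ∣ p ∣
∈-ofSize⁺ [] = here refl
∈-ofSize⁺ (inside ∷ p) = ∈-++⁺ˡ (∈-map⁺ (inside ∷_) (∈-ofSize⁺ p))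
∈-ofSize⁺ {suc m} (outside ∷ p) with ∣ p ∣ | ∈-ofSize⁺ p
... | zero | p∈ = ∈-map⁺ (outside ∷_) p∈
... | suc _ | p∈ = ∈-++⁺ʳ (map (inside ∷_) (ofSize m _)) (∈-map⁺ (outside ∷_) p∈)

∈-ofSize⁻ : ∀ m k {p : Subset m} → p ∈ˡ ofSize m k → ∣ p ∣ ≡ k
∈-ofSize⁻ zero zero {[]} _ = refl
∈-ofSize⁻ (suc m) zero p∈ with ∈-map⁻ (outside ∷_) p∈
... | _ , q∈ , refl = ∈-ofSize⁻ m zero q∈
∈-ofSize⁻ (suc m) (suc k) p∈ with ∈-++⁻ (map (inside ∷_) (ofSize m k)) p∈
... | inj₁ p∈ˡ with ∈-map⁻ (inside ∷_) p∈ˡ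
...   | _ , q∈ , refl = cong suc (∈-ofSize⁻ m k q∈)
∈-ofSize⁻ (suc m) (suc k) p∈ | inj₂ p∈ʳ with ∈-map⁻ (outside ∷_) p∈ʳ
...   | _ , q∈ , refl = ∈-ofSize⁻ m (suc k) q∈

module Order (L : FiniteLattice) where

  open FiniteLattice L public
  open IsBoundedLattice isBoundedLattice public
    using (x∧y≤x; x∧y≤y; ∧-greatest; x≤x∨y; y≤x∨y; ∨-least; maximum)
  open IsPartialOrder (IsBoundedLattice.isPartialOrder isBoundedLattice) public
    using () renaming (refl to ≤-refl; trans to ≤-trans; antisym to ≤-antisym)

  El : Set
  El = Fin size

  _<_ : El → El → Set
  x < y = (x ≤ y) × (x ≢ y)

  <-≤-trans : ∀ {x y z} → x < y → y ≤ z → x < z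
  <-≤-trans (x≤y , x≢y) y≤z = ≤-trans x≤y y≤z , λ { refl → x≢y (≤-antisym x≤y y≤z) }

  ≤⇒∧≡ : ∀ {x y} → x ≤ y → x ∧ y ≡ x
  ≤⇒∧≡ x≤y = ≤-antisym (x∧y≤x _ _) (∧-greatest ≤-refl x≤y)

  ∧≡⇒≤ : ∀ {x y} → x ∧ y ≡ x → x ≤ y
  ∧≡⇒≤ {x} {y} eq = subst (_≤ y) eq (x∧y≤y x y)

  _≤?_ : ∀ x y → Dec (x ≤ y)
  x ≤? y = map′ ∧≡⇒≤ ≤⇒∧≡ ((x ∧ y) ≟ x)

  _<?_ : ∀ x y → Dec (x < y)
  x <? y = (x ≤? y) ×-dec ¬? (x ≟ y)

  strictDownset : El → Subset size
  strictDownset x = select (_<? x)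

  strictDownset-⊂ : ∀ {x y} → x < y → strictDownset x ⊂ strictDownset y
  strictDownset-⊂ {x} x<y =
    (λ z∈ → ∈-select⁺ (_<? _) (<-≤-trans (∈-select⁻ (_<? x) z∈) (proj₁ x<y))) ,
    x , ∈-select⁺ (_<? _) x<y , λ x∈ → proj₂ (∈-select⁻ (_<? x) x∈) refl

  <-wellFounded : WellFounded _<_
  <-wellFounded = Subrelation.wellFounded (p⊂q⇒∣p∣<∣q∣ ∘ strictDownset-⊂)
                    (On.wellFounded (∣_∣ ∘ strictDownset) <ℕ-wellFounded)

  module _ {T : Subset size} where

    chain⇒≤ : ∀ {x y j} → Chain L T x y j → x ≤ y
    chain⇒≤ (here _) = ≤-refl
    chain⇒≤ (step _ x<y c) = ≤-trans (proj₁ x<y) (chain⇒≤ c)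

    chain⇒< : ∀ {x y j} → Chain L T x y (suc j) → x < y
    chain⇒< (step _ x<y c) = <-≤-trans x<y (chain⇒≤ c)

    chain-start∈ : ∀ {x y j} → Chain L T x y j → x ∈ T
    chain-start∈ (here x∈T) = x∈T
    chain-start∈ (step x∈T _ _) = x∈T

    chain-end∈ : ∀ {x y j} → Chain L T x y j → y ∈ T
    chain-end∈ (here y∈T) = y∈T
    chain-end∈ (step _ _ c) = chain-end∈ c

    chain-∷ʳ : ∀ {x y z j} → Chain L T x y j → y < z → z ∈ T → Chain L T x z (suc j)
    chain-∷ʳ (here y∈T) y<z z∈T = step y∈T y<z (here z∈T)
    chain-∷ʳ (step x∈T x<w c) y<z z∈T = step x∈T x<w (chain-∷ʳ c y<z z∈T)

    chain-⊤ : ∀ {x y j} → Chain L T x y j → Chain L ⊤ x y j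
    chain-⊤ (here _) = here ∈⊤
    chain-⊤ (step _ x<w c) = step ∈⊤ x<w (chain-⊤ c)

  chain-extendʳ : ∀ {x y z j} → y ≤ z → Chain L ⊤ x y j → Σ ℕ λ j′ → j ≤ℕ j′ × Chain L ⊤ x z j′
  chain-extendʳ {y = y} {z} y≤z c with y ≟ z
  ... | yes refl = _ , ℕₚ.≤-refl , c
  ... | no y≢z = _ , ℕₚ.n≤1+n _ , chain-∷ʳ c (y≤z , y≢z) ∈⊤

  chain-extendˡ : ∀ {w x y j} → w ≤ x → Chain L ⊤ x y j → Σ ℕ λ j′ → j ≤ℕ j′ × Chain L ⊤ w y j′
  chain-extendˡ {w} {x} w≤x c with w ≟ x
  ... | yes refl = _ , ℕₚ.≤-refl , c
  ... | no w≢x = _ , ℕₚ.n≤1+n _ , step ∈⊤ (w≤x , w≢x) c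

  chain-length≤height : ∀ {n T x y j} → LatticeHeight L n → Chain L T x y j → j ≤ℕ n
  chain-length≤height (o , (_ , o-least) , _ , maximal) c
    with chain-extendʳ (maximum _) (chain-⊤ c)
  ... | j₁ , j≤j₁ , c₁ with chain-extendˡ (o-least _ ∈⊤) c₁
  ... | j₂ , j₁≤j₂ , c₂ = ℕₚ.≤-trans j≤j₁ (ℕₚ.≤-trans j₁≤j₂ (maximal j₂ c₂))

  Card-cong : ∀ {P Q : El → Set} {c} → (∀ x → P x ⇔ Q x) → Card L P c → Card L Q c
  Card-cong P⇔Q (xs , xs-unique , xs⇔ , len) = xs , xs-unique , (λ x → ⇔.trans (xs⇔ x) (P⇔Q x)) , len

  module _ {S : Subset size} where

    atom⇔height1 : ∀ {x} → IsAtomIn L S x ⇔ (x ∈ S × HeightIn L S x 1)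
    atom⇔height1 {x} = mk⇔ to from
      where
      to : IsAtomIn L S x → x ∈ S × HeightIn L S x 1
      to (o , o-least , o∈S , x∈S , o<x , nothingBetween) =
        x∈S , o , o-least , step o∈S o<x (here x∈S) , maximal
        where
        maximal : ∀ j → Chain L S o x j → j ≤ℕ 1
        maximal _ (here _) = z≤n
        maximal _ (step _ _ (here _)) = s≤s z≤n
        maximal _ (step _ o<y c@(step y∈S _ _)) = ⊥-elim (nothingBetween _ y∈S o<y (chain⇒< c))
      from : x ∈ S × HeightIn L S x 1 → IsAtomIn L S x
      from (x∈S , o , o-least , step o∈S o<x (here _) , maximal) =
        o , o-least , o∈S , x∈S , o<x ,
        λ c c∈S o<c c<x → ℕₚ.<-irrefl refl (maximal 2 (step o∈S o<c (step c∈S c<x (here x∈S))))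

    atoms-antichain : ∀ {a b} → IsAtomIn L S a → IsAtomIn L S b → a ≤ b → a ≡ b
    atoms-antichain {a} {b} (o , (o∈S , o-least) , _ , a∈S , (_ , o≢a) , _)
                            (o′ , (o′∈S , o′-least) , _ , _ , _ , nothingBelow) a≤b
      with a ≟ b
    ... | yes a≡b = a≡b
    ... | no a≢b = ⊥-elim (nothingBelow a a∈S (o′-least a a∈S , o′≢a) (a≤b , a≢b))
      where
      o′≢a : o′ ≢ a
      o′≢a refl = o≢a (≤-antisym (o-least o′ o′∈S) (o′-least o o∈S))

module DistributiveSublattice (L : FiniteLattice) {S : Subset (FiniteLattice.size L)}
  (sublattice : IsSublattice L S) (distributive : DistributiveOn L S) where

  open Order L

  ∨-closed : ∀ {x y} → x ∈ S → y ∈ S → x ∨ y ∈ S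
  ∨-closed x∈S y∈S = proj₁ (proj₂ sublattice _ _ x∈S y∈S)

  ∧-closed : ∀ {x y} → x ∈ S → y ∈ S → x ∧ y ∈ S
  ∧-closed x∈S y∈S = proj₂ (proj₂ sublattice _ _ x∈S y∈S)

  foldr-∧-closed : ∀ {x ys} → x ∈ S → All (_∈ S) ys → foldr _∧_ x ys ∈ S
  foldr-∧-closed x∈S [] = x∈S
  foldr-∧-closed x∈S (y∈S ∷ ys∈S) = ∧-closed y∈S (foldr-∧-closed x∈S ys∈S)

  foldr-∧-≤ : ∀ {x y ys} → y ∈ˡ ys → foldr _∧_ x ys ≤ y
  foldr-∧-≤ (here refl) = x∧y≤x _ _
  foldr-∧-≤ (there y∈ys) = ≤-trans (x∧y≤y _ _) (foldr-∧-≤ y∈ys)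

  ⊥S : El
  ⊥S = foldr _∧_ (proj₁ (proj₁ sublattice)) (filter (_∈? S) (allFin size))

  ⊥S∈S : ⊥S ∈ S
  ⊥S∈S = foldr-∧-closed (proj₂ (proj₁ sublattice)) (all-filter (_∈? S) (allFin size))

  ⊥S-least : ∀ {y} → y ∈ S → ⊥S ≤ y
  ⊥S-least {y} y∈S = foldr-∧-≤ (∈-filter⁺ (_∈? S) (∈-allFin y) y∈S)

  ⊥S-isLeast : IsLeastIn L S ⊥S
  ⊥S-isLeast = ⊥S∈S , λ _ → ⊥S-least

  isLeast⇒≡⊥S : ∀ {o} → IsLeastIn L S o → o ≡ ⊥S
  isLeast⇒≡⊥S (o∈S , o-least) = ≤-antisym (o-least ⊥S ⊥S∈S) (⊥S-least o∈S)

  Decomposable : El → Set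
  Decomposable x = ∃₂ λ a b → a ∈ S × b ∈ S × a < x × b < x × a ∨ b ≡ x

  decomposable? : Decidable Decomposable
  decomposable? x = any? λ a → any? λ b →
    (a ∈? S) ×-dec (b ∈? S) ×-dec (a <? x) ×-dec (b <? x) ×-dec ((a ∨ b) ≟ x)

  JoinIrreducible : El → Set
  JoinIrreducible x = x ∈ S × x ≢ ⊥S × ¬ Decomposable x

  joinIrreducible? : Decidable JoinIrreducible
  joinIrreducible? x = (x ∈? S) ×-dec ¬? (x ≟ ⊥S) ×-dec ¬? (decomposable? x)

  joinIrreducible-split : ∀ {j a b} → JoinIrreducible j → a ∈ S → b ∈ S
    → a ≤ j → b ≤ j → a ∨ b ≡ j → a ≡ j ⊎ b ≡ j
  joinIrreducible-split {j} {a} {b} (_ , _ , indecomposable) a∈S b∈S a≤j b≤j a∨b≡j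
    with a ≟ j | b ≟ j
  ... | yes a≡j | _ = inj₁ a≡j
  ... | no _ | yes b≡j = inj₂ b≡j
  ... | no a≢j | no b≢j =
    ⊥-elim (indecomposable (a , b , a∈S , b∈S , (a≤j , a≢j) , (b≤j , b≢j) , a∨b≡j))

  joinIrreducible⇒joinPrime : ∀ {j a b} → JoinIrreducible j → a ∈ S → b ∈ S
    → j ≤ (a ∨ b) → j ≤ a ⊎ j ≤ b
  joinIrreducible⇒joinPrime {j} {a} {b} ji@(j∈S , _) a∈S b∈S j≤a∨b =
    Sum.map ∧≡⇒≤ ∧≡⇒≤
      (joinIrreducible-split ji (∧-closed j∈S a∈S) (∧-closed j∈S b∈S)
                                (x∧y≤x j a) (x∧y≤x j b) meets-join)
    where
    meets-join : (j ∧ a) ∨ (j ∧ b) ≡ j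
    meets-join = begin
      (j ∧ a) ∨ (j ∧ b) ≡⟨ sym (distributive j a b j∈S a∈S b∈S) ⟩
      j ∧ (a ∨ b)       ≡⟨ ≤⇒∧≡ j≤a∨b ⟩
      j                 ∎
      where open ≡-Reasoning

  irreducibles : List El
  irreducibles = filter joinIrreducible? (allFin size)

  #irreducibles : ℕ
  #irreducibles = length irreducibles

  ι : Fin #irreducibles → El
  ι = lookup irreducibles

  ι-irreducible : ∀ i → JoinIrreducible (ι i)
  ι-irreducible i = proj₂ (∈-filter⁻ joinIrreducible? {xs = allFin size} (∈-lookup i))

  ι-∈S : ∀ i → ι i ∈ S
  ι-∈S = proj₁ ∘ ι-irreducible

  ι-injective : ∀ {i j} → ι i ≡ ι j → i ≡ j
  ι-injective = lookup-injective (Unique.filter⁺ joinIrreducible? (Unique.allFin⁺ size)) _ _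

  irreducible⇒∈ι : ∀ {x} → JoinIrreducible x → ∃ λ i → ι i ≡ x
  irreducible⇒∈ι {x} ji = index x∈ , sym (lookup-index x∈)
    where
    x∈ : x ∈ˡ irreducibles
    x∈ = ∈-filter⁺ joinIrreducible? (∈-allFin x) ji

  ⋁ : ∀ {k} → (Fin k → El) → Subset k → El
  ⋁ F [] = ⊥S
  ⋁ F (inside ∷ p) = F zero ∨ ⋁ (F ∘ suc) p
  ⋁ F (outside ∷ p) = ⋁ (F ∘ suc) p

  ⋁-closed : ∀ {k} (F : Fin k → El) → (∀ i → F i ∈ S) → ∀ p → ⋁ F p ∈ S
  ⋁-closed F F∈S [] = ⊥S∈S
  ⋁-closed F F∈S (inside ∷ p) = ∨-closed (F∈S zero) (⋁-closed (F ∘ suc) (F∈S ∘ suc) p)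
  ⋁-closed F F∈S (outside ∷ p) = ⋁-closed (F ∘ suc) (F∈S ∘ suc) p

  ≤-⋁ : ∀ {k} (F : Fin k → El) {p i} → i ∈ p → F i ≤ ⋁ F p
  ≤-⋁ F {inside ∷ p} here = x≤x∨y _ _
  ≤-⋁ F {inside ∷ p} (there i∈p) = ≤-trans (≤-⋁ (F ∘ suc) i∈p) (y≤x∨y _ _)
  ≤-⋁ F {outside ∷ p} (there i∈p) = ≤-⋁ (F ∘ suc) i∈p

  ⋁-least : ∀ {k} (F : Fin k → El) {p z} → ⊥S ≤ z → (∀ {i} → i ∈ p → F i ≤ z) → ⋁ F p ≤ z
  ⋁-least F {[]} ⊥S≤z _ = ⊥S≤z
  ⋁-least F {inside ∷ p} ⊥S≤z F≤z = ∨-least (F≤z here) (⋁-least (F ∘ suc) ⊥S≤z (F≤z ∘ there))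
  ⋁-least F {outside ∷ p} ⊥S≤z F≤z = ⋁-least (F ∘ suc) ⊥S≤z (F≤z ∘ there)

  ⋁-mono : ∀ {k} (F : Fin k → El) → (∀ i → F i ∈ S) → ∀ {p q} → p ⊆ q → ⋁ F p ≤ ⋁ F q
  ⋁-mono F F∈S {q = q} p⊆q = ⋁-least F (⊥S-least (⋁-closed F F∈S q)) (≤-⋁ F ∘ p⊆q)

  irreducible≤⋁ : ∀ {k} (F : Fin k → El) → (∀ i → F i ∈ S) → ∀ {j} p → JoinIrreducible j
    → j ≤ ⋁ F p → ∃ λ i → i ∈ p × j ≤ F i
  irreducible≤⋁ F F∈S [] (j∈S , j≢⊥S , _) j≤⊥S = ⊥-elim (j≢⊥S (≤-antisym j≤⊥S (⊥S-least j∈S)))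
  irreducible≤⋁ F F∈S (inside ∷ p) ji j≤⋁
    with joinIrreducible⇒joinPrime ji (F∈S zero) (⋁-closed (F ∘ suc) (F∈S ∘ suc) p) j≤⋁
  ... | inj₁ j≤F₀ = zero , here , j≤F₀
  ... | inj₂ j≤⋁′ with irreducible≤⋁ (F ∘ suc) (F∈S ∘ suc) p ji j≤⋁′
  ...   | i , i∈p , j≤Fi = suc i , there i∈p , j≤Fi
  irreducible≤⋁ F F∈S (outside ∷ p) ji j≤⋁ with irreducible≤⋁ (F ∘ suc) (F∈S ∘ suc) p ji j≤⋁
  ... | i , i∈p , j≤Fi = suc i , there i∈p , j≤Fi

  below : El → Subset #irreducibles
  below x = select (λ i → ι i ≤? x)

  ∈-below⁺ : ∀ {i x} → ι i ≤ x → i ∈ below x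
  ∈-below⁺ {x = x} = ∈-select⁺ (λ i → ι i ≤? x)

  ∈-below⁻ : ∀ {i x} → i ∈ below x → ι i ≤ x
  ∈-below⁻ {x = x} = ∈-select⁻ (λ i → ι i ≤? x)

  below-mono : ∀ {x y} → x ≤ y → below x ⊆ below y
  below-mono x≤y i∈ = ∈-below⁺ (≤-trans (∈-below⁻ i∈) x≤y)

  ≤-⋁-below : ∀ {x} → x ∈ S → Acc _<_ x → x ≤ ⋁ ι (below x)
  ≤-⋁-below {x} x∈S (acc rs) with x ≟ ⊥S | decomposable? x
  ... | yes refl | _ = ⊥S-least (⋁-closed ι ι-∈S (below x))
  ... | no x≢⊥S | no indecomposable with irreducible⇒∈ι (x∈S , x≢⊥S , indecomposable)
  ...   | i , refl = ≤-⋁ ι (∈-below⁺ ≤-refl)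
  ≤-⋁-below {x} x∈S (acc rs) | no _ | yes (a , b , a∈S , b∈S , a<x , b<x , a∨b≡x) =
    subst (_≤ ⋁ ι (below x)) a∨b≡x (∨-least (part a∈S a<x) (part b∈S b<x))
    where
    part : ∀ {a} → a ∈ S → a < x → a ≤ ⋁ ι (below x)
    part a∈S a<x = ≤-trans (≤-⋁-below a∈S (rs a<x)) (⋁-mono ι ι-∈S (below-mono (proj₁ a<x)))

  ⋁-below : ∀ {x} → x ∈ S → ⋁ ι (below x) ≡ x
  ⋁-below {x} x∈S = ≤-antisym (⋁-least ι (⊥S-least x∈S) ∈-below⁻) (≤-⋁-below x∈S (<-wellFounded x))

  below-injective : ∀ {x y} → x ∈ S → y ∈ S → below x ≡ below y → x ≡ y
  below-injective {x} {y} x∈S y∈S eq = begin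
    x                  ≡⟨ sym (⋁-below x∈S) ⟩
    ⋁ ι (below x)      ≡⟨ cong (⋁ ι) eq ⟩
    ⋁ ι (below y)      ≡⟨ ⋁-below y∈S ⟩
    y                  ∎
    where open ≡-Reasoning

  rank : El → ℕ
  rank x = ∣ below x ∣

  rank-⊥S : rank ⊥S ≡ 0
  rank-⊥S = ℕₚ.n≤0⇒n≡0 (subst (rank ⊥S ≤ℕ_) (∣⊥∣≡0 #irreducibles) (p⊆q⇒∣p∣≤∣q∣ below-⊥S⊆⊥))
    where
    below-⊥S⊆⊥ : below ⊥S ⊆ ⊥
    below-⊥S⊆⊥ {i} i∈ =
      ⊥-elim (proj₁ (proj₂ (ι-irreducible i)) (≤-antisym (∈-below⁻ i∈) (⊥S-least (ι-∈S i))))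

  rank-strict : ∀ {x y} → x ∈ S → y ∈ S → x < y → rank x <ℕ rank y
  rank-strict x∈S y∈S (x≤y , x≢y) =
    p⊂q⇒∣p∣<∣q∣ (⊆∧≢⇒⊂ (below-mono x≤y) (x≢y ∘ below-injective x∈S y∈S))

  rank-cover : ∀ {x y} → CoversIn L S x y → rank y ≡ suc (rank x)
  rank-cover {x} {y} (x∈S , y∈S , x<y@(x≤y , _) , nothingBetween) =
    ℕₚ.≤-antisym (∣q∣≤1+∣p∣ (below-mono x≤y) new-unique) (rank-strict x∈S y∈S x<y)
    where
    x∨new≡y : ∀ {i} → i ∈ below y → i ∉ below x → x ∨ ι i ≡ y
    x∨new≡y {i} i∈y i∉x with (x ∨ ι i) ≟ y
    ... | yes eq = eq
    ... | no x∨ιi≢y = ⊥-elim (nothingBetween (x ∨ ι i) (∨-closed x∈S (ι-∈S i)) x<x∨ιi x∨ιi<y)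
      where
      x<x∨ιi : x < (x ∨ ι i)
      x<x∨ιi = x≤x∨y x (ι i) ,
        λ x≡x∨ιi → i∉x (∈-below⁺ (subst (ι i ≤_) (sym x≡x∨ιi) (y≤x∨y x (ι i))))
      x∨ιi<y : (x ∨ ι i) < y
      x∨ιi<y = ∨-least x≤y (∈-below⁻ i∈y) , x∨ιi≢y
    new-≤ : ∀ {i j} → i ∈ below y → i ∉ below x → j ∈ below y → j ∉ below x → ι i ≤ ι j
    new-≤ {i} {j} i∈y i∉x j∈y j∉x
      with joinIrreducible⇒joinPrime (ι-irreducible i) x∈S (ι-∈S j)
             (subst (ι i ≤_) (sym (x∨new≡y j∈y j∉x)) (∈-below⁻ i∈y))
    ... | inj₁ ιi≤x = ⊥-elim (i∉x (∈-below⁺ ιi≤x))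
    ... | inj₂ ιi≤ιj = ιi≤ιj
    new-unique : AtMostOneNew (below x) (below y)
    new-unique i∈y i∉x j∈y j∉x =
      ι-injective (≤-antisym (new-≤ i∈y i∉x j∈y j∉x) (new-≤ j∈y j∉x i∈y i∉x))

  cover-below : ∀ {x z} → x ∈ S → z ∈ S → x < z → Acc _<_ z → ∃ λ y → CoversIn L S x y × y ≤ z
  cover-below {x} {z} x∈S z∈S x<z (acc rs) with any? (λ c → (c ∈? S) ×-dec (x <? c) ×-dec (c <? z))
  ... | no nothingBetween =
    z , (x∈S , z∈S , x<z , λ c c∈S x<c c<z → nothingBetween (c , c∈S , x<c , c<z)) , ≤-refl
  ... | yes (c , c∈S , x<c , c<z) with cover-below x∈S c∈S x<c (rs c<z)
  ...   | y , x⋖y , y≤c = y , x⋖y , ≤-trans y≤c (proj₁ c<z)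

  rank-chain : ∀ {x y j} → Chain L S x y j → rank x + j ≤ℕ rank y
  rank-chain {x} (here _) = ℕₚ.≤-reflexive (ℕₚ.+-identityʳ (rank x))
  rank-chain {x} {j = suc j} (step x∈S x<w c) = begin
    rank x + suc j    ≡⟨ ℕₚ.+-suc (rank x) j ⟩
    suc (rank x) + j  ≤⟨ ℕₚ.+-monoˡ-≤ j (rank-strict x∈S (chain-start∈ c) x<w) ⟩
    rank _ + j        ≤⟨ rank-chain c ⟩
    rank _            ∎
    where open ℕₚ.≤-Reasoning

  saturated-chain : ∀ d {x y} → x ∈ S → y ∈ S → x ≤ y → rank x + d ≡ rank y → Chain L S x y d
  saturated-chain d {x} {y} x∈S y∈S x≤y eq with x ≟ y | d
  ... | yes refl | zero = here x∈S
  ... | yes refl | suc _ = ⊥-elim (ℕₚ.m+1+n≢m (rank x) eq)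
  ... | no x≢y | zero =
    ⊥-elim (ℕₚ.<⇒≢ (rank-strict x∈S y∈S (x≤y , x≢y)) (trans (sym (ℕₚ.+-identityʳ (rank x))) eq))
  ... | no x≢y | suc d′ with cover-below x∈S y∈S (x≤y , x≢y) (<-wellFounded y)
  ...   | z , x⋖z@(_ , z∈S , x<z , _) , z≤y =
    step x∈S x<z (saturated-chain d′ z∈S y∈S z≤y (begin
      rank z + d′         ≡⟨ cong (_+ d′) (rank-cover x⋖z) ⟩
      suc (rank x) + d′   ≡⟨ ℕₚ.+-suc (rank x) d′ ⟨
      rank x + suc d′     ≡⟨ eq ⟩
      rank y              ∎))
    where open ≡-Reasoning

  chain-from-⊥S : ∀ {x} → x ∈ S → Chain L S ⊥S x (rank x)
  chain-from-⊥S {x} x∈S = saturated-chain (rank x) ⊥S∈S x∈S (⊥S-least x∈S) (cong (_+ rank x) rank-⊥S)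

  chain-from-⊥S-length : ∀ {x j} → Chain L S ⊥S x j → j ≤ℕ rank x
  chain-from-⊥S-length {x} {j} c = subst (λ r → r + j ≤ℕ rank x) rank-⊥S (rank-chain c)

  height⇒rank : ∀ {x k} → HeightIn L S x k → rank x ≡ k
  height⇒rank (o , o-least , c , maximal) with isLeast⇒≡⊥S o-least
  ... | refl = ℕₚ.≤-antisym (maximal _ (chain-from-⊥S (chain-end∈ c))) (chain-from-⊥S-length c)

  rank⇒height : ∀ {x} → x ∈ S → HeightIn L S x (rank x)
  rank⇒height x∈S = ⊥S , ⊥S-isLeast , chain-from-⊥S x∈S , λ _ → chain-from-⊥S-length

  below∈ofSize : ∀ {x k} → HeightIn L S x k → below x ∈ˡ ofSize #irreducibles k
  below∈ofSize {x} height =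
    subst (λ r → below x ∈ˡ ofSize #irreducibles r) (height⇒rank height) (∈-ofSize⁺ (below x))

  whitney≤choose : ∀ {k c} → Whitney L S k c → c ≤ℕ #irreducibles C k
  whitney≤choose {k} {c} (xs , xs-unique , xs⇔ , refl) = begin
    length xs                        ≤⟨ injection⇒length≤ below xs-unique injective into ⟩
    length (ofSize #irreducibles k)  ≡⟨ length-ofSize #irreducibles k ⟩
    #irreducibles C k                ∎
    where
    open ℕₚ.≤-Reasoning
    whitney : ∀ {x} → x ∈ˡ xs → x ∈ S × HeightIn L S x k
    whitney {x} = Equivalence.to (xs⇔ x)
    injective : ∀ {x y} → x ∈ˡ xs → y ∈ˡ xs → below x ≡ below y → x ≡ y
    injective x∈ y∈ = below-injective (proj₁ (whitney x∈)) (proj₁ (whitney y∈))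
    into : ∀ {x} → x ∈ˡ xs → below x ∈ˡ ofSize #irreducibles k
    into x∈ = below∈ofSize (proj₂ (whitney x∈))

  #irreducibles≤height : ∀ {n} → LatticeHeight L n → #irreducibles ≤ℕ n
  #irreducibles≤height height = begin
    #irreducibles                ≡⟨ ∣⊤∣≡n #irreducibles ⟨
    ∣ ⊤ {#irreducibles} ∣        ≤⟨ p⊆q⇒∣p∣≤∣q∣ {p = ⊤} (λ {i} _ → ∈-below⁺ (≤-⋁ ι {p = ⊤} (∈⊤ {x = i}))) ⟩
    rank (⋁ ι ⊤)                 ≤⟨ chain-length≤height height (chain-from-⊥S (⋁-closed ι ι-∈S ⊤)) ⟩
    _                            ∎
    where open ℕₚ.≤-Reasoning

  module _ (ι-antichain : ∀ {i j} → ι i ≤ ι j → i ≡ j) where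

    below-⋁ : ∀ p → below (⋁ ι p) ≡ p
    below-⋁ p = ⊆-antisym below⊆p (λ i∈p → ∈-below⁺ (≤-⋁ ι i∈p))
      where
      below⊆p : below (⋁ ι p) ⊆ p
      below⊆p i∈ with irreducible≤⋁ ι ι-∈S p (ι-irreducible _) (∈-below⁻ i∈)
      ... | j , j∈p , ιi≤ιj = subst (_∈ p) (sym (ι-antichain ιi≤ιj)) j∈p

    ⋁ι-injective : ∀ {p q} → ⋁ ι p ≡ ⋁ ι q → p ≡ q
    ⋁ι-injective {p} {q} eq = trans (sym (below-⋁ p)) (trans (cong below eq) (below-⋁ q))

    whitney-antichain : ∀ k → Whitney L S k (#irreducibles C k)
    whitney-antichain k =
      map (⋁ ι) (ofSize #irreducibles k) ,
      Unique.map⁺ ⋁ι-injective (ofSize-unique #irreducibles k) ,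
      (λ x → mk⇔ to from) ,
      trans (length-map (⋁ ι) (ofSize #irreducibles k)) (length-ofSize #irreducibles k)
      where
      to : ∀ {x} → x ∈ˡ map (⋁ ι) (ofSize #irreducibles k) → x ∈ S × HeightIn L S x k
      to x∈ with ∈-map⁻ (⋁ ι) x∈
      ... | p , p∈ , refl = ⋁-closed ι ι-∈S p ,
        subst (HeightIn L S (⋁ ι p)) (trans (cong ∣_∣ (below-⋁ p)) (∈-ofSize⁻ #irreducibles k p∈))
          (rank⇒height (⋁-closed ι ι-∈S p))
      from : ∀ {x} → x ∈ S × HeightIn L S x k → x ∈ˡ map (⋁ ι) (ofSize #irreducibles k)
      from {x} (x∈S , height) = subst (_∈ˡ map (⋁ ι) (ofSize #irreducibles k)) (⋁-below x∈S)
        (∈-map⁺ (⋁ ι) (below∈ofSize height))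

  atom⇒irreducible : ∀ {a} → IsAtomIn L S a → JoinIrreducible a
  atom⇒irreducible {a} (o , o-least , (_ , a∈S , (_ , o≢a) , nothingBetween)) with isLeast⇒≡⊥S o-least
  ... | refl = a∈S , o≢a ∘ sym , indecomposable
    where
    <atom⇒≡⊥S : ∀ {c} → c ∈ S → c < a → c ≡ ⊥S
    <atom⇒≡⊥S {c} c∈S c<a with c ≟ ⊥S
    ... | yes c≡⊥S = c≡⊥S
    ... | no c≢⊥S = ⊥-elim (nothingBetween c c∈S (⊥S-least c∈S , c≢⊥S ∘ sym) c<a)
    indecomposable : ¬ Decomposable a
    indecomposable (b , c , b∈S , c∈S , b<a , c<a , b∨c≡a)
      with <atom⇒≡⊥S b∈S b<a | <atom⇒≡⊥S c∈S c<a
    ... | refl | refl = o≢a (trans (≤-antisym (x≤x∨y ⊥S ⊥S) (∨-least ≤-refl ≤-refl)) b∨c≡a)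

  module _ {n} (height : LatticeHeight L n) where

    whitney⇒atoms : (∀ k → k ≤ℕ n → Whitney L S k (n C k)) → Card L (IsAtomIn L S) n
    whitney⇒atoms whitney with 1 ≤ℕ? n
    ... | yes 1≤n =
      Card-cong (λ _ → ⇔.sym atom⇔height1) (subst (Whitney L S 1) (nC1≡n n) (whitney 1 1≤n))
    ... | no 1≰n =
      [] , [] , (λ _ → mk⇔ (λ ()) (⊥-elim ∘ 1≰n ∘ atom⇒1≤height)) , sym (ℕₚ.n<1⇒n≡0 (ℕₚ.≰⇒> 1≰n))
      where
      atom⇒1≤height : ∀ {a} → IsAtomIn L S a → 1 ≤ℕ n
      atom⇒1≤height (_ , _ , o∈S , a∈S , o<a , _) = chain-length≤height height (step o∈S o<a (here a∈S))

    atoms⇒whitney : Card L (IsAtomIn L S) n → ∀ k → Whitney L S k (n C k)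
    atoms⇒whitney (as , as-unique , as⇔ , refl) k =
      subst (λ m → Whitney L S k (m C k)) #irreducibles≡#atoms (whitney-antichain ι-antichain k)
      where
      as⊆irreducibles : ∀ {a} → a ∈ˡ as → a ∈ˡ irreducibles
      as⊆irreducibles {a} a∈ =
        ∈-filter⁺ joinIrreducible? (∈-allFin a) (atom⇒irreducible (Equivalence.to (as⇔ a) a∈))
      #irreducibles≡#atoms : #irreducibles ≡ length as
      #irreducibles≡#atoms = ℕₚ.≤-antisym (#irreducibles≤height height)
        (injection⇒length≤ id as-unique (λ _ _ eq → eq) as⊆irreducibles)
      ι-atom : ∀ i → IsAtomIn L S (ι i)
      ι-atom i = Equivalence.to (as⇔ (ι i))
        (unique-⊆⇒⊇ _≟_ as-unique as⊆irreducibles (ℕₚ.≤-reflexive #irreducibles≡#atoms) (∈-lookup i))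
      ι-antichain : ∀ {i j} → ι i ≤ ι j → i ≡ j
      ι-antichain {i} {j} ιi≤ιj = ι-injective (atoms-antichain (ι-atom i) (ι-atom j) ιi≤ιj)

open import Data.Nat using (_≤_)

corollary5 : (L' : FiniteLattice) (n : ℕ) → Geometric L' → LatticeHeight L' n
    → (S : Subset (FiniteLattice.size L')) → IsSublattice L' S → DistributiveOn L' S
    → (∀ k c → k ≤ n → Whitney L' S k c → c ≤ n C k)
    × ((∀ k → k ≤ n → Whitney L' S k (n C k)) ⇔ Card L' (IsAtomIn L' S) n)
corollary5 L' n _ height S sublattice distributive =
  (λ k c _ W → ℕₚ.≤-trans (whitney≤choose W) (C-monoˡ-≤ k (#irreducibles≤height height))) ,
  mk⇔ (whitney⇒atoms height) (λ atoms k _ → atoms⇒whitney height atoms k)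
  where open DistributiveSublattice L' sublattice distributive
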